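{- Let $p$ be an odd prime, let $a$ and $k$ be positive integers with $a<p$, and let $n=ap^k+1$. If $p^k\mid\varphi(n)$, then $n$ is prime.
   Context: $\varphi$ denotes Euler's totient function. -}

module Defs where

open import Data.Nat using (ℕ; suc; _≟_)
open import Data.Nat.GCD using (gcd)
open import Data.List using (List; length; filter; upTo; map)
open import Relation.Nullary.Decidable using (Dec)

-- Euler's totient: φ n = #{ m ∈ {1,…,n} : gcd m n = 1 }.
-- (φ 0 = 0 by this convention; irrelevant here since n ≥ 2.)
φ : ℕ → ℕ
φ n = length (filter (λ m → gcd m n ≟ 1) (map suc (upTo n)))

-- Factor n = a pᵏ + 1 into primes q₁ ⋯ qᵣ (with multiplicity). Since φ(n) divides ∏ (qᵢ - 1) · n
-- and p ∤ n, the hypothesis gives pᵏ ∣ ∏ (qᵢ - 1). If n were composite we would get n ≥ pᵏ⁺¹,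
-- contradicting n = a pᵏ + 1 < pᵏ⁺¹. If some qᵢ ≢ 1 (mod p), the product of those qᵢ is ≡ n ≡ 1
-- (mod p), hence exceeds p, while the qᵢ ≡ 1 (mod p) contribute at least pᵏ. If all qᵢ ≡ 1 (mod p),
-- then the qᵢ - 1 are even multiples of p; let j be their least p-adic valuation. For j ≥ k two
-- factors already give p²ᵏ; for j < k, reducing n ≡ 1 (mod pʲ⁺¹) shows that the cofactors of the
-- qᵢ - 1 of valuation exactly j sum to a multiple of p, so their product supplies a further factor ≥ p.

module Submission where

open import Level using (Level)
open import Data.Bool.Base using (true; false; if_then_else_)
open import Data.List.Base using (List; []; _∷_; _++_; [_]; _∷ʳ_; map; filter; length; upTo)
open import Data.List.Properties using (filter-++; length-++; map-++; map-∘; map-id-local; upTo-∷ʳ)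
open import Data.List.Relation.Unary.All as All using (All; []; _∷_; all?)
open import Data.List.Relation.Unary.All.Properties using (all-filter; filter⁺; filter⁻; map⁺; map⁻)
open import Data.List.Relation.Binary.Permutation.Propositional using (_↭_; prep; ↭-refl; ↭-trans; ↭-sym)
open import Data.List.Relation.Binary.Permutation.Propositional.Properties using (shift)
  renaming (map⁺ to ↭-map⁺)
open import Data.Nat
open import Data.Nat.Properties
open import Data.Nat.Divisibility
open import Data.Nat.Coprimality using (Coprime; coprime?; coprime-+; coprime-divisor; coprime⇒gcd≡1; gcd≡1⇒coprime)
open import Data.Nat.GCD using (gcd)
open import Data.Nat.ListAction using (sum; product)
open import Data.Nat.ListAction.Properties using (sum-↭; product-↭; sum-++; product-++; product≢0)
open import Data.Nat.Primality
open import Data.Nat.Primality.Factorisation using (factorise)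
open import Data.Nat.Tactic.RingSolver using (solve-∀)
open import Data.Product.Base using (_×_; _,_; proj₁; ∃-syntax)
open import Data.Sum.Base using (_⊎_; inj₁; inj₂; [_,_]′)
open import Function.Base using (id; _∘_)
open import Function.Bundles using (_⇔_; mk⇔; Equivalence)
open import Relation.Nullary using (¬_; Dec; yes; no; does; ¬?)
open import Relation.Nullary.Decidable using (dec-false; does-⇔; _×-dec_)
open import Relation.Nullary.Negation using (contradiction)
open import Relation.Unary using (Pred; Decidable)
open import Relation.Unary.Properties using (_∩?_; ∁?)
open import Relation.Binary.PropositionalEquality hiding ([_])

open import Defs

private
  variable
    ℓ ℓ′ : Level
    X Y : Set ℓ
    P : Pred ℕ ℓ
    Q : Pred ℕ ℓ′
    a d m n k p q j : ℕ
    xs bs qs : List ℕ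

prime-power-divisor : Prime p → ¬ p ∣ m → p ^ k ∣ m * n → p ^ k ∣ n
prime-power-divisor {k = zero}  _ _ _ = 1∣ _
prime-power-divisor {p} {m} {suc k} {n} p-prime p∤m pᵏ⁺¹∣mn
  with euclidsLemma m n p-prime (∣-trans (m∣m*n (p ^ k)) pᵏ⁺¹∣mn)
... | inj₁ p∣m = contradiction p∣m p∤m
... | inj₂ (divides n′ refl) =
  subst (_∣ n′ * p) (*-comm (p ^ k) p) (*-monoˡ-∣ p (prime-power-divisor {k = k} p-prime p∤m pᵏ∣mn′))
  where
  instance _ = prime⇒nonZero p-prime
  pᵏ∣mn′ : p ^ k ∣ m * n′
  pᵏ∣mn′ = *-cancelˡ-∣ p (subst (p * p ^ k ∣_) (equation m n′ p) pᵏ⁺¹∣mn)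
    where
    equation : ∀ m n p → m * (n * p) ≡ p * (m * n)
    equation = solve-∀

prime∤1 : Prime p → ¬ p ∣ 1
prime∤1 p-prime p∣1 = nonTrivial⇒≢1 {{prime⇒nonTrivial p-prime}} (∣1⇒≡1 p∣1)

prime∣^⇒∣ : Prime p → p ∣ m ^ n → p ∣ m
prime∣^⇒∣ {n = zero}  p-prime p∣1 = contradiction p∣1 (prime∤1 p-prime)
prime∣^⇒∣ {m = m} {n = suc n} p-prime p∣mᵐ⁺¹ =
  [ id , prime∣^⇒∣ {n = n} p-prime ]′ (euclidsLemma m (m ^ n) p-prime p∣mᵐ⁺¹)

prime∤product : Prime p → All (λ x → ¬ p ∣ x) xs → ¬ p ∣ product xs
prime∤product p-prime []             = prime∤1 p-prime
prime∤product p-prime (p∤x ∷ p∤xs) p∣∏ =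
  [ p∤x , prime∤product p-prime p∤xs ]′ (euclidsLemma _ _ p-prime p∣∏)

^-monoʳ-∣ : ∀ p → m ≤ n → p ^ m ∣ p ^ n
^-monoʳ-∣ {m} {n} p m≤n = divides (p ^ (n ∸ m)) (begin
  p ^ n                ≡⟨ cong (p ^_) (m+[n∸m]≡n m≤n) ⟨
  p ^ (m + (n ∸ m))    ≡⟨ ^-distribˡ-+-* p m (n ∸ m) ⟩
  p ^ m * p ^ (n ∸ m)  ≡⟨ *-comm (p ^ m) _ ⟩
  p ^ (n ∸ m) * p ^ m  ∎)
  where open ≡-Reasoning

m∣m^n : ∀ m → 1 ≤ n → m ∣ m ^ n
m∣m^n m 1≤n = ∣-trans (m∣m*n 1) (^-monoʳ-∣ m 1≤n)

2∣n⊎2∣1+n : ∀ n → 2 ∣ n ⊎ 2 ∣ suc n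
2∣n⊎2∣1+n zero    = inj₁ (2 ∣0)
2∣n⊎2∣1+n (suc n) = [ inj₂ ∘ ∣m∣n⇒∣m+n (∣-refl {2}) , inj₁ ]′ (2∣n⊎2∣1+n n)

-- If q ≡ 1 (mod p) then q ≠ 2, so q is odd.
prime∣pred⇒2∣pred : Prime p → Prime q → p ∣ pred q → 2 ∣ pred q
prime∣pred⇒2∣pred {q = suc q′} p-prime q-prime p∣q′ with 2∣n⊎2∣1+n q′
... | inj₁ 2∣q′ = 2∣q′
... | inj₂ 2∣q  with prime⇒irreducible q-prime 2∣q
...   | inj₂ refl = contradiction p∣q′ (prime∤1 p-prime)

-- d ∣ pred m encodes m ≡ 1 (mod d); it also holds for m = 0, where pred 0 = 0.
∣pred-* : d ∣ pred m → d ∣ pred n → d ∣ pred (m * n)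
∣pred-* {m = zero}                   _     _     = _ ∣0
∣pred-* {d} {m = suc m} {n = zero}   _     _     = subst (λ x → d ∣ pred x) (sym (*-zeroʳ m)) (d ∣0)
∣pred-* {m = suc m} {n = suc n}      d∣m   d∣n   = ∣m∣n⇒∣m+n d∣n (∣m⇒∣m*n (suc n) d∣m)

∣pred-*-cancelˡ : .{{_ : NonZero m}} .{{_ : NonZero n}} → d ∣ pred m → d ∣ pred (m * n) → d ∣ pred n
∣pred-*-cancelˡ {suc m} {suc n} {d} d∣m d∣mn =
  ∣m+n∣m⇒∣n (subst (d ∣_) (+-comm n (m * suc n)) d∣mn) (∣m⇒∣m*n (suc n) d∣m)

∣pred-product : All (λ x → d ∣ pred x) xs → d ∣ pred (product xs)
∣pred-product []           = _ ∣0
∣pred-product {xs = x ∷ xs} (d∣x ∷ d∣xs) = ∣pred-* {m = x} d∣x (∣pred-product d∣xs)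

prime∣pred⇒∤ : Prime p → .{{_ : NonZero n}} → p ∣ pred n → ¬ p ∣ n
prime∣pred⇒∤ {p} {suc n} p-prime p∣n p∣1+n =
  prime∤1 p-prime (∣m+n∣m⇒∣n (subst (p ∣_) (+-comm 1 n) p∣1+n) p∣n)

prime⇒pred≢0 : Prime q → NonZero (pred q)
prime⇒pred≢0 {q} q-prime = >-nonZero (pred-mono-≤ (nonTrivial⇒n>1 q {{prime⇒nonTrivial q-prime}}))

all-∣-sum : All (d ∣_) xs → d ∣ sum xs
all-∣-sum []           = _ ∣0
all-∣-sum (d∣x ∷ d∣xs) = ∣m∣n⇒∣m+n d∣x (all-∣-sum d∣xs)

m+n≤m*n : 2 ≤ m → 2 ≤ n → m + n ≤ m * n
m+n≤m*n {suc (suc m)} {suc (suc n)} (s≤s (s≤s _)) (s≤s (s≤s _)) = begin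
  2 + m + (2 + n)                    ≤⟨ m≤m+n (2 + m + (2 + n)) (m + n + m * n) ⟩
  2 + m + (2 + n) + (m + n + m * n)  ≡⟨ equation m n ⟩
  (2 + m) * (2 + n)                  ∎
  where
  open ≤-Reasoning
  equation : ∀ m n → 2 + m + (2 + n) + (m + n + m * n) ≡ (2 + m) * (2 + n)
  equation = solve-∀

2≤⇒nonZero : 2 ≤ n → NonZero n
2≤⇒nonZero (s≤s _) = _

sum≤product : All (2 ≤_) xs → sum xs ≤ product xs
sum≤product []                          = z≤n
sum≤product (_∷_ {x} _ [])              = ≤-reflexive (trans (+-identityʳ x) (sym (*-identityʳ x)))
sum≤product (_∷_ {x} 2≤x xs≥2@(_∷_ {y} {ys} 2≤y ys≥2)) = begin
  x + sum (y ∷ ys)      ≤⟨ +-monoʳ-≤ x (sum≤product xs≥2) ⟩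
  x + product (y ∷ ys)  ≤⟨ m+n≤m*n 2≤x 2≤product ⟩
  x * product (y ∷ ys)  ∎
  where
  open ≤-Reasoning
  2≤product : 2 ≤ product (y ∷ ys)
  2≤product = *-mono-≤ 2≤y (>-nonZero⁻¹ _ {{product≢0 (All.map 2≤⇒nonZero ys≥2)}})

product-map-pred≤product : ∀ xs → product (map pred xs) ≤ product xs
product-map-pred≤product []       = ≤-refl
product-map-pred≤product (x ∷ xs) = *-mono-≤ (pred[n]≤n {x}) (product-map-pred≤product xs)

product-map-*ʳ : ∀ m xs → product (map (_* m) xs) ≡ product xs * m ^ length xs
product-map-*ʳ m []       = refl
product-map-*ʳ m (x ∷ xs) =
  trans (cong (x * m *_) (product-map-*ʳ m xs)) (equation x m (product xs) (m ^ length xs))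
  where
  equation : ∀ x m P M → x * m * (P * M) ≡ x * P * (m * M)
  equation = solve-∀

multiples⇒map-*ʳ : All (m ∣_) xs → ∃[ bs ] xs ≡ map (_* m) bs
multiples⇒map-*ʳ []                      = [] , refl
multiples⇒map-*ʳ (divides b refl ∷ m∣xs) with multiples⇒map-*ʳ m∣xs
... | bs , refl = b ∷ bs , refl

↭-filter-∁ : (P? : Decidable P) → ∀ xs → xs ↭ filter P? xs ++ filter (∁? P?) xs
↭-filter-∁ P? []       = ↭-refl
↭-filter-∁ P? (x ∷ xs) with P? x
... | yes _ = prep x (↭-filter-∁ P? xs)
... | no  _ = ↭-trans (prep x (↭-filter-∁ P? xs)) (↭-sym (shift x (filter P? xs) (filter (∁? P?) xs)))

product-filter-∁ : (P? : Decidable P) → ∀ xs → product xs ≡ product (filter P? xs) * product (filter (∁? P?) xs)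
product-filter-∁ P? xs = trans (product-↭ (↭-filter-∁ P? xs)) (product-++ (filter P? xs) _)

sum-filter-∁ : (P? : Decidable P) → ∀ xs → sum xs ≡ sum (filter P? xs) + sum (filter (∁? P?) xs)
sum-filter-∁ P? xs = trans (sum-↭ (↭-filter-∁ P? xs)) (sum-++ (filter P? xs) _)

product-map-filter-∁ : ∀ (f : ℕ → ℕ) (P? : Decidable P) xs →
  product (map f xs) ≡ product (map f (filter P? xs)) * product (map f (filter (∁? P?) xs))
product-map-filter-∁ f P? xs = begin
  product (map f xs)
    ≡⟨ product-↭ (↭-map⁺ f (↭-filter-∁ P? xs)) ⟩
  product (map f (filter P? xs ++ filter (∁? P?) xs))
    ≡⟨ cong product (map-++ f (filter P? xs) _) ⟩
  product (map f (filter P? xs) ++ map f (filter (∁? P?) xs))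
    ≡⟨ product-++ (map f (filter P? xs)) _ ⟩
  product (map f (filter P? xs)) * product (map f (filter (∁? P?) xs)) ∎
  where open ≡-Reasoning

filter-∁≢[] : (P? : Decidable P) → ¬ All P xs → filter (∁? P?) xs ≢ []
filter-∁≢[] {xs = xs} P? ¬all empty = ¬all (filter⁻ P? (all-filter P? xs) (subst (All _) (sym empty) []))

persists⊎breaks : Decidable P → ∀ {i} → P i → ∀ d →
                  P (d + i) ⊎ ∃[ j ] (i ≤ j × j < d + i × P j × ¬ P (suc j))
persists⊎breaks P? Pᵢ zero = inj₁ Pᵢ
persists⊎breaks P? {i} Pᵢ (suc d) with persists⊎breaks P? Pᵢ d
... | inj₂ (j , i≤j , j<d+i , Pⱼ , ¬Pⱼ₊₁) = inj₂ (j , i≤j , m<n⇒m<1+n j<d+i , Pⱼ , ¬Pⱼ₊₁)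
... | inj₁ P[d+i] with P? (suc (d + i))
...   | yes P[1+d+i] = inj₁ P[1+d+i]
...   | no ¬P[1+d+i] = inj₂ (d + i , m≤n+m i d , ≤-refl , P[d+i] , ¬P[1+d+i])

product-1+*ʳ : ∀ m bs → ∃[ t ] product (map (λ b → suc (b * m)) bs) ≡ suc ((sum bs + t * m) * m)
product-1+*ʳ m []       = 0 , refl
product-1+*ʳ m (b ∷ bs) with product-1+*ʳ m bs
... | t , eq = b * (sum bs + t * m) + t , trans (cong (suc (b * m) *_) eq) (equation b m (sum bs) t)
  where
  equation : ∀ b m s t → suc (b * m) * suc ((s + t * m) * m) ≡ suc ((b + s + (b * (s + t * m) + t) * m) * m)
  equation = solve-∀

∣pred-product-1+*ʳ⇒∣sum : .{{_ : NonZero m}} → d ∣ m →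
                          d * m ∣ pred (product (map (λ b → suc (b * m)) bs)) → d ∣ sum bs
∣pred-product-1+*ʳ⇒∣sum {m} {d} {bs} d∣m dm∣ with product-1+*ʳ m bs
... | t , eq = ∣m+n∣m⇒∣n (subst (d ∣_) (+-comm (sum bs) (t * m)) d∣sum+tm) (∣n⇒∣m*n t d∣m)
  where
  d∣sum+tm : d ∣ sum bs + t * m
  d∣sum+tm = *-cancelʳ-∣ m (subst (λ x → d * m ∣ pred x) eq dm∣)

∣sum⇒≤product : All (2 ≤_) xs → xs ≢ [] → d ∣ sum xs → d ≤ product xs
∣sum⇒≤product []                      xs≢[] _    = contradiction refl xs≢[]
∣sum⇒≤product xs≥2@(_∷_ {x} 2≤x _) _ d∣sum =
  ≤-trans (∣⇒≤ {{2≤⇒nonZero (≤-trans 2≤x (m≤m+n x _))}} d∣sum) (sum≤product xs≥2)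

square≤product : 2 ≤ length xs → All NonZero xs → All (d ∣_) xs → d * d ≤ product xs
square≤product {x₁ ∷ x₂ ∷ xs} {d} (s≤s (s≤s _)) (x₁≢0 ∷ x₂≢0 ∷ xs≢0) (d∣x₁ ∷ d∣x₂ ∷ _) = begin
  d * d                    ≤⟨ *-mono-≤ (∣⇒≤ {{x₁≢0}} d∣x₁) (∣⇒≤ {{x₂≢0}} d∣x₂) ⟩
  x₁ * x₂                  ≤⟨ m≤m*n (x₁ * x₂) (product xs) {{product≢0 xs≢0}} ⟩
  x₁ * x₂ * product xs     ≡⟨ *-assoc x₁ x₂ _ ⟩
  product (x₁ ∷ x₂ ∷ xs)   ∎
  where open ≤-Reasoning

indicator : Dec X → ℕ
indicator a? = if does a? then 1 else 0

indicator-no : (a? : Dec X) → ¬ X → indicator a? ≡ 0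
indicator-no a? ¬a = cong (if_then 1 else 0) (dec-false a? ¬a)

indicator-⇔ : X ⇔ Y → (a? : Dec X) (b? : Dec Y) → indicator a? ≡ indicator b?
indicator-⇔ X⇔Y a? b? = cong (if_then 1 else 0) (does-⇔ X⇔Y a? b?)

indicator-split : (a? : Dec X) (b? : Dec Y) →
                  indicator a? ≡ indicator (a? ×-dec b?) + indicator (a? ×-dec ¬? b?)
indicator-split (yes _) (yes _) = refl
indicator-split (yes _) (no _)  = refl
indicator-split (no _)  _       = refl

indicator-×-dec-yes : (a? : Dec X) (b? : Dec Y) → Y → indicator (a? ×-dec b?) ≡ indicator a?
indicator-×-dec-yes (yes _) (yes _) _ = refl
indicator-×-dec-yes (no _)  _       _ = refl
indicator-×-dec-yes (yes _) (no ¬b) b = contradiction b ¬b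

-- Counts over [1, n] rather than [0, n), the range used in the definition of φ.
count : Decidable P → ℕ → ℕ
count P? zero    = 0
count P? (suc n) = count P? n + indicator (P? (suc n))

count-cong : (P? : Decidable P) (Q? : Decidable Q) → (∀ x → P x ⇔ Q x) →
             ∀ n → count P? n ≡ count Q? n
count-cong P? Q? P⇔Q zero    = refl
count-cong P? Q? P⇔Q (suc n) =
  cong₂ _+_ (count-cong P? Q? P⇔Q n) (indicator-⇔ (P⇔Q (suc n)) (P? (suc n)) (Q? (suc n)))

count-none : (P? : Decidable P) → ∀ n → (∀ x → x < n → ¬ P (suc x)) → count P? n ≡ 0
count-none P? zero    _    = refl
count-none P? (suc n) none =
  cong₂ _+_ (count-none P? n (λ x x<n → none x (m<n⇒m<1+n x<n))) (indicator-no (P? (suc n)) (none n ≤-refl))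

count-+ : (P? : Decidable P) → ∀ m n → count P? (m + n) ≡ count P? m + count (λ x → P? (m + x)) n
count-+ P? m zero    = trans (cong (count P?) (+-identityʳ m)) (sym (+-identityʳ _))
count-+ P? m (suc n) = begin
  count P? (m + suc n)
    ≡⟨ cong (count P?) (+-suc m n) ⟩
  count P? (m + n) + indicator (P? (suc (m + n)))
    ≡⟨ cong₂ _+_ (count-+ P? m n) (cong (indicator ∘ P?) (sym (+-suc m n))) ⟩
  count P? m + count (λ x → P? (m + x)) n + indicator (P? (m + suc n))
    ≡⟨ +-assoc (count P? m) _ _ ⟩
  count P? m + count (λ x → P? (m + x)) (suc n) ∎
  where open ≡-Reasoning

count-periodic : (P? : Decidable P) → (∀ x → P (m + x) ⇔ P x) →
                 ∀ q → count P? (q * m) ≡ q * count P? m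
count-periodic P? per zero = refl
count-periodic {m = m} P? per (suc q) = begin
  count P? (m + q * m)                           ≡⟨ count-+ P? m (q * m) ⟩
  count P? m + count (λ x → P? (m + x)) (q * m)  ≡⟨ cong (count P? m +_) (count-cong _ P? per (q * m)) ⟩
  count P? m + count P? (q * m)                  ≡⟨ cong (count P? m +_) (count-periodic P? per q) ⟩
  count P? m + q * count P? m                    ∎
  where open ≡-Reasoning

count-∩∁ : (P? : Decidable P) (Q? : Decidable Q) →
           ∀ n → count P? n ≡ count (P? ∩? Q?) n + count (P? ∩? ∁? Q?) n
count-∩∁ P? Q? zero    = refl
count-∩∁ P? Q? (suc n) = begin
  count P? n + indicator (P? (suc n))
    ≡⟨ cong₂ _+_ (count-∩∁ P? Q? n) (indicator-split (P? (suc n)) (Q? (suc n))) ⟩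
  (count (P? ∩? Q?) n + count (P? ∩? ∁? Q?) n) + (indicator ((P? ∩? Q?) (suc n)) + indicator ((P? ∩? ∁? Q?) (suc n)))
    ≡⟨ interchange (count (P? ∩? Q?) n) (count (P? ∩? ∁? Q?) n) _ _ ⟩
  count (P? ∩? Q?) (suc n) + count (P? ∩? ∁? Q?) (suc n) ∎
  where
  open ≡-Reasoning
  interchange : ∀ a b c e → (a + b) + (c + e) ≡ (a + c) + (b + e)
  interchange = solve-∀

-- In a block of q consecutive numbers ending at a multiple of q, only the last one is a multiple.
count-multiples : (P? : Decidable P) → ∀ q .{{_ : NonZero q}} m →
                  count (P? ∩? (q ∣?_)) (m * q) ≡ count (λ y → P? (y * q)) m
count-multiples P? q zero = refl
count-multiples P? q@(suc q′) (suc m) = begin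
  count R? (q + m * q)                                ≡⟨ cong (count R?) (+-comm q (m * q)) ⟩
  count R? (m * q + q)                                ≡⟨ count-+ R? (m * q) q ⟩
  count R? (m * q) + count (λ x → R? (m * q + x)) q   ≡⟨ cong₂ _+_ (count-multiples P? q m) last-block ⟩
  count (λ y → P? (y * q)) m + indicator (P? (suc m * q)) ∎
  where
  open ≡-Reasoning
  R? = P? ∩? (q ∣?_)
  last-block : count (λ x → R? (m * q + x)) q ≡ indicator (P? (suc m * q))
  last-block = cong₂ _+_
    (count-none _ q′ (λ x x<q′ (_ , q∣) → <⇒≱ (s≤s x<q′) (∣⇒≤ (∣m+n∣m⇒∣n q∣ (n∣m*n m)))))
    (trans (cong (indicator ∘ R?) (+-comm (m * q) q)) (indicator-×-dec-yes (P? _) (q ∣? _) (n∣m*n (suc m))))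

length-filter-upTo : (P? : Decidable P) → ∀ n → length (filter P? (map suc (upTo n))) ≡ count P? n
length-filter-upTo P? zero    = refl
length-filter-upTo P? (suc n) = begin
  length (filter P? (map suc (upTo (suc n))))
    ≡⟨ cong (length ∘ filter P? ∘ map suc) (sym (upTo-∷ʳ n)) ⟩
  length (filter P? (map suc (upTo n ∷ʳ n)))
    ≡⟨ cong (length ∘ filter P?) (map-++ suc (upTo n) [ n ]) ⟩
  length (filter P? (map suc (upTo n) ++ [ suc n ]))
    ≡⟨ cong length (filter-++ P? (map suc (upTo n)) [ suc n ]) ⟩
  length (filter P? (map suc (upTo n)) ++ filter P? [ suc n ])
    ≡⟨ length-++ (filter P? (map suc (upTo n))) ⟩
  length (filter P? (map suc (upTo n))) + length (filter P? [ suc n ])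
    ≡⟨ cong₂ _+_ (length-filter-upTo P? n) (length-filter-[-] (suc n)) ⟩
  count P? (suc n) ∎
  where
  open ≡-Reasoning
  length-filter-[-] : ∀ x → length (filter P? [ x ]) ≡ indicator (P? x)
  length-filter-[-] x with does (P? x)
  ... | true  = refl
  ... | false = refl

φ≡count-coprime : ∀ n → φ n ≡ count (λ x → coprime? x n) n
φ≡count-coprime n = trans (length-filter-upTo _ n)
  (count-cong _ _ (λ x → mk⇔ gcd≡1⇒coprime coprime⇒gcd≡1) n)

coprime-+ˡ⇔ : ∀ m x → Coprime (m + x) m ⇔ Coprime x m
coprime-+ˡ⇔ m x = mk⇔ (λ c {d} (d∣x , d∣m) → c (∣m∣n⇒∣m+n d∣m d∣x , d∣m)) coprime-+

coprime-*-prime⇔ : Prime q → ∀ m x → Coprime x (q * m) ⇔ (Coprime x m × ¬ q ∣ x)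
coprime-*-prime⇔ {q} q-prime m x = mk⇔
  (λ c → (λ {d} (d∣x , d∣m) → c (d∣x , ∣n⇒∣m*n q d∣m)) , λ q∣x → q≢1 (c (q∣x , m∣m*n m)))
  λ (c , q∤x) {d} (d∣x , d∣qm) →
    [ id , (λ { refl → contradiction d∣x q∤x }) ]′
      (prime⇒irreducible q-prime (coprime-divisor (λ {e} (e∣d , e∣m) → c (∣-trans e∣d d∣x , e∣m))
                                                   (subst (d ∣_) (*-comm q m) d∣qm)))
  where q≢1 = nonTrivial⇒≢1 {{prime⇒nonTrivial q-prime}}

coprime-*ʳ-prime⇔ : Prime q → ¬ q ∣ m → ∀ y → Coprime (y * q) m ⇔ Coprime y m
coprime-*ʳ-prime⇔ {q} {m} q-prime q∤m y = mk⇔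
  (λ c {d} (d∣y , d∣m) → c (∣m⇒∣m*n q d∣y , d∣m))
  λ c {d} (d∣yq , d∣m) → c (coprime-divisor (coprime-to-q d∣m) (subst (d ∣_) (*-comm y q) d∣yq) , d∣m)
  where
  coprime-to-q : ∀ {d} → d ∣ m → Coprime d q
  coprime-to-q d∣m {e} (e∣d , e∣q) =
    [ id , (λ { refl → contradiction (∣-trans e∣d d∣m) q∤m }) ]′ (prime⇒irreducible q-prime e∣q)

φ-*-∣ : Prime q → q ∣ m → φ (q * m) ≡ q * φ m
φ-*-∣ {q} {m} q-prime q∣m = begin
  φ (q * m)                                    ≡⟨ φ≡count-coprime (q * m) ⟩
  count (λ x → coprime? x (q * m)) (q * m)     ≡⟨ count-cong _ _ coprime-to-qm⇔m (q * m) ⟩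
  count (λ x → coprime? x m) (q * m)           ≡⟨ count-periodic _ (coprime-+ˡ⇔ m) q ⟩
  q * count (λ x → coprime? x m) m             ≡⟨ cong (q *_) (φ≡count-coprime m) ⟨
  q * φ m                                      ∎
  where
  open ≡-Reasoning
  coprime-to-qm⇔m : ∀ x → Coprime x (q * m) ⇔ Coprime x m
  coprime-to-qm⇔m x = mk⇔ (proj₁ ∘ to) λ c →
    from (c , λ q∣x → nonTrivial⇒≢1 {{prime⇒nonTrivial q-prime}} (c (q∣x , q∣m)))
    where open Equivalence (coprime-*-prime⇔ q-prime m x)

φ-*-∤ : Prime q → ¬ q ∣ m → φ (q * m) ≡ pred q * φ m
φ-*-∤ {q@(suc q′)} {m} q-prime q∤m = +-cancelʳ-≡ (φ m) _ _ (begin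
  φ (q * m) + φ m
    ≡⟨ cong₂ _+_ (trans (φ≡count-coprime (q * m)) (count-cong _ _ (coprime-*-prime⇔ q-prime m) (q * m)))
                 (sym multiples-of-q) ⟩
  count (C? ∩? ∁? D?) (q * m) + count (C? ∩? D?) (q * m) ≡⟨ +-comm (count (C? ∩? ∁? D?) (q * m)) _ ⟩
  count (C? ∩? D?) (q * m) + count (C? ∩? ∁? D?) (q * m) ≡⟨ count-∩∁ C? D? (q * m) ⟨
  count C? (q * m)                                       ≡⟨ count-periodic C? (coprime-+ˡ⇔ m) q ⟩
  q * count C? m                                         ≡⟨ cong (q *_) (φ≡count-coprime m) ⟨
  φ m + q′ * φ m                                         ≡⟨ +-comm (φ m) _ ⟩
  q′ * φ m + φ m                                         ∎)
  where
  open ≡-Reasoning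
  C? = λ x → coprime? x m
  D? = q ∣?_
  multiples-of-q : count (C? ∩? D?) (q * m) ≡ φ m
  multiples-of-q = begin
    count (C? ∩? D?) (q * m)             ≡⟨ cong (count (C? ∩? D?)) (*-comm q m) ⟩
    count (C? ∩? D?) (m * q)             ≡⟨ count-multiples C? q m ⟩
    count (λ y → coprime? (y * q) m) m   ≡⟨ count-cong _ _ (coprime-*ʳ-prime⇔ q-prime q∤m) m ⟩
    count C? m                           ≡⟨ φ≡count-coprime m ⟨
    φ m                                  ∎

*-∣-rearrange : ∀ {r} s t x m → r ∣ s * t → r * (x * m) ∣ s * x * (t * m)
*-∣-rearrange s t x m r∣st = ∣-trans (*-monoˡ-∣ (x * m) r∣st) (∣-reflexive (equation s t x m))
  where
  equation : ∀ s t x m → s * t * (x * m) ≡ s * x * (t * m)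
  equation = solve-∀

φ-product∣ : All Prime qs → φ (product qs) ∣ product (map pred qs) * product qs
φ-product∣ []                           = ∣-refl
φ-product∣ {q ∷ qs} (q-prime ∷ qs-prime) with q ∣? product qs
... | yes q∣M = subst (_∣ product (map pred (q ∷ qs)) * product (q ∷ qs)) (sym (φ-*-∣ q-prime q∣M))
  (∣-trans (*-monoʳ-∣ q (φ-product∣ qs-prime))
           (*-∣-rearrange {q} (pred q) q (product (map pred qs)) (product qs) (n∣m*n (pred q))))
... | no  q∤M = subst (_∣ product (map pred (q ∷ qs)) * product (q ∷ qs)) (sym (φ-*-∤ q-prime q∤M))
  (∣-trans (*-monoʳ-∣ (pred q) (φ-product∣ qs-prime))
           (*-∣-rearrange {pred q} (pred q) q (product (map pred qs)) (product qs) (m∣m*n q)))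

p^k∣φ⇒∣product-pred : Prime p → All Prime qs → ¬ p ∣ product qs →
                       p ^ k ∣ φ (product qs) → p ^ k ∣ product (map pred qs)
p^k∣φ⇒∣product-pred {p} {qs} {k} p-prime qs-prime p∤N pᵏ∣φN = prime-power-divisor {k = k} p-prime p∤N
  (subst (p ^ k ∣_) (*-comm (product (map pred qs)) _) (∣-trans pᵏ∣φN (φ-product∣ qs-prime)))

-- Among the xᵢ = bᵢ pʲ, those of valuation exactly j (p ∤ bᵢ) have Σ bᵢ ≡ 0 (mod p), because
-- ∏ (1 + xᵢ) ≡ 1 + pʲ Σ bᵢ (mod pʲ⁺¹); as all bᵢ ≥ 2, their product B is at least that sum, so
-- B ≥ p, while p ∤ B leaves pᵏ to divide the remaining factor W.
p^[1+k]≤product-at-valuation : Prime p → 1 ≤ j → j < k → All (2 ≤_) bs → ¬ All (p ∣_) bs →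
                               p ^ k ∣ pred (product (map (λ b → suc (b * p ^ j)) bs)) →
                               p ^ k ∣ product (map (_* p ^ j) bs) →
                               p ^ suc k ≤ product (map (_* p ^ j) bs)
p^[1+k]≤product-at-valuation {p} {j} {k} {bs} p-prime 1≤j j<k bs≥2 ¬p∣bs pᵏ∣N-1 pᵏ∣X = begin
  p * p ^ k                    ≤⟨ *-mono-≤ p≤B pᵏ≤W ⟩
  B * W                        ≡⟨ X≡B*W ⟨
  product (map (_* p ^ j) bs)  ∎
  where
  open ≤-Reasoning
  instance
    _ = prime⇒nonZero p-prime
    _ = m^n≢0 p j
  D? = p ∣?_
  B = product (filter (∁? D?) bs)
  W = product (filter D? bs) * (p ^ j) ^ length bs

  p∣sum : p ∣ sum bs
  p∣sum = ∣pred-product-1+*ʳ⇒∣sum {bs = bs} (m∣m^n p 1≤j) (∣-trans (^-monoʳ-∣ p j<k) pᵏ∣N-1)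

  p≤B : p ≤ B
  p≤B = ∣sum⇒≤product (filter⁺ (∁? D?) bs≥2) (filter-∁≢[] D? ¬p∣bs)
    (∣m+n∣m⇒∣n (subst (p ∣_) (sum-filter-∁ D? bs) p∣sum) (all-∣-sum (all-filter D? bs)))

  X≡B*W : product (map (_* p ^ j) bs) ≡ B * W
  X≡B*W = begin-equality
    product (map (_* p ^ j) bs)                       ≡⟨ product-map-*ʳ (p ^ j) bs ⟩
    product bs * (p ^ j) ^ length bs                  ≡⟨ cong (_* (p ^ j) ^ length bs) (product-filter-∁ D? bs) ⟩
    product (filter D? bs) * B * (p ^ j) ^ length bs  ≡⟨ equation (product (filter D? bs)) B _ ⟩
    B * W                                             ∎
    where
    equation : ∀ a b c → a * b * c ≡ b * (a * c)
    equation = solve-∀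

  pᵏ≤W : p ^ k ≤ W
  pᵏ≤W = ∣⇒≤ {{W≢0}} (prime-power-divisor {k = k} p-prime (prime∤product p-prime (all-filter (∁? D?) bs))
                                            (subst (p ^ k ∣_) X≡B*W pᵏ∣X))
    where
    W≢0 : NonZero W
    W≢0 = m*n≢0 _ _ {{product≢0 (filter⁺ D? (All.map 2≤⇒nonZero bs≥2))}} {{m^n≢0 (p ^ j) (length bs)}}

-- Either every xᵢ is divisible by pᵏ, and two factors suffice, or there is a least valuation j < k.
p^[1+k]≤product-of-multiples : Prime p → ¬ 2 ∣ p → 1 ≤ k → 2 ≤ length xs →
                               All NonZero xs → All (2 ∣_) xs → All (p ∣_) xs →
                               p ^ k ∣ pred (product (map suc xs)) → p ^ k ∣ product xs →
                               p ^ suc k ≤ product xs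
p^[1+k]≤product-of-multiples {p} {k} {xs} p-prime p-odd 1≤k 2≤len xs≢0 2∣xs p∣xs pᵏ∣N-1 pᵏ∣X
  with persists⊎breaks (λ j → all? (p ^ j ∣?_) xs) (All.map (∣-trans (∣-reflexive (*-identityʳ p))) p∣xs) (k ∸ 1)
... | inj₁ pᵏ∣xs = begin
  p * p ^ k      ≤⟨ *-monoˡ-≤ (p ^ k) (∣⇒≤ {{m^n≢0 p k}} (m∣m^n p 1≤k)) ⟩
  p ^ k * p ^ k  ≤⟨ square≤product 2≤len xs≢0 (subst (λ i → All (p ^ i ∣_) xs) (m∸n+n≡m 1≤k) pᵏ∣xs) ⟩
  product xs     ∎
  where
  open ≤-Reasoning
  instance _ = prime⇒nonZero p-prime
... | inj₂ (j , 1≤j , j<k , pʲ∣xs , ¬pʲ⁺¹∣xs) with multiples⇒map-*ʳ pʲ∣xs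
...   | bs , refl =
  p^[1+k]≤product-at-valuation p-prime 1≤j (subst (j <_) (m∸n+n≡m 1≤k) j<k) bs≥2 ¬p∣bs
    (subst (λ ys → p ^ k ∣ pred (product ys)) (sym (map-∘ bs)) pᵏ∣N-1) pᵏ∣X
  where
  even⇒≥2 : ∀ {b} → NonZero (b * p ^ j) × 2 ∣ b * p ^ j → 2 ≤ b
  even⇒≥2 {b} (b*pʲ≢0 , 2∣b*pʲ) = ∣⇒≤ {{m*n≢0⇒m≢0 b {{b*pʲ≢0}}}}
    ([ id , (λ 2∣pʲ → contradiction (prime∣^⇒∣ {n = j} prime[2] 2∣pʲ) p-odd) ]′
       (euclidsLemma b (p ^ j) prime[2] 2∣b*pʲ))

  bs≥2 : All (2 ≤_) bs
  bs≥2 = All.zipWith even⇒≥2 (map⁻ xs≢0 , map⁻ 2∣xs)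

  ¬p∣bs : ¬ All (p ∣_) bs
  ¬p∣bs p∣bs = ¬pʲ⁺¹∣xs (map⁺ (All.map (*-monoˡ-∣ (p ^ j)) p∣bs))

-- With S = {qᵢ ≡ 1 (mod p)} and R ≠ [] the rest, ∏ R ≡ ∏ qs ≡ 1 (mod p) gives ∏ R > p,
-- while pᵏ, being coprime to ∏_R (qᵢ - 1), divides ∏_S (qᵢ - 1) < ∏ S.
p^[1+k]≤product-¬all-p∣pred : Prime p → All Prime qs → ¬ All (λ q → p ∣ pred q) qs →
                              p ∣ pred (product qs) → p ^ k ∣ product (map pred qs) →
                              p ^ suc k ≤ product qs
p^[1+k]≤product-¬all-p∣pred {p} {qs} {k} p-prime qs-prime ¬all p∣N-1 pᵏ∣X = begin
  p * p ^ k    ≤⟨ *-mono-≤ p≤∏R pᵏ≤∏S ⟩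
  ∏R * ∏S      ≡⟨ *-comm ∏R ∏S ⟩
  ∏S * ∏R      ≡⟨ product-filter-∁ S? qs ⟨
  product qs   ∎
  where
  open ≤-Reasoning
  S? = λ q → p ∣? pred q
  S = filter S? qs
  R = filter (∁? S?) qs
  ∏S = product S
  ∏R = product R
  S-prime = filter⁺ S? qs-prime
  R-prime = filter⁺ (∁? S?) qs-prime

  pᵏ≤∏S : p ^ k ≤ ∏S
  pᵏ≤∏S = ≤-trans (∣⇒≤ {{product≢0 (map⁺ (All.map prime⇒pred≢0 S-prime))}} pᵏ∣∏pred[S])
                  (product-map-pred≤product S)
    where
    pᵏ∣∏pred[S] : p ^ k ∣ product (map pred S)
    pᵏ∣∏pred[S] = prime-power-divisor {k = k} p-prime (prime∤product p-prime (map⁺ (all-filter (∁? S?) qs)))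
      (subst (p ^ k ∣_) (trans (product-map-filter-∁ pred S? qs) (*-comm (product (map pred S)) _)) pᵏ∣X)

  p≤∏R : p ≤ ∏R
  p≤∏R = ≤-trans (∣⇒≤ {{>-nonZero (pred-mono-≤ 2≤∏R)}} p∣∏R-1) pred[n]≤n
    where
    instance
      _ = productOfPrimes≢0 S-prime
      _ = productOfPrimes≢0 R-prime
    p∣∏R-1 : p ∣ pred ∏R
    p∣∏R-1 = ∣pred-*-cancelˡ {∏S} (∣pred-product (all-filter S? qs))
                              (subst (λ n → p ∣ pred n) (product-filter-∁ S? qs) p∣N-1)
    2≤∏R : 2 ≤ ∏R
    2≤∏R with R | R-prime | filter-∁≢[] S? ¬all
    ... | []    | _                  | R≢[] = contradiction refl R≢[]
    ... | r ∷ _ | r-prime ∷ rs-prime | _    =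
      *-mono-≤ (nonTrivial⇒n>1 r {{prime⇒nonTrivial r-prime}}) (productOfPrimes≥1 rs-prime)

p^[1+k]≤product-of-primes : Prime p → ¬ 2 ∣ p → 1 ≤ k → All Prime qs → Composite (product qs) →
                            p ^ k ∣ pred (product qs) → p ^ k ∣ product (map pred qs) →
                            p ^ suc k ≤ product qs
p^[1+k]≤product-of-primes _ _ _ [] 1-composite _ _ =
  contradiction (nonTrivial⇒n>1 1 {{composite⇒nonTrivial 1-composite}}) (<-irrefl refl)
p^[1+k]≤product-of-primes _ _ _ (q-prime ∷ []) q-composite _ _ =
  contradiction (subst Prime (sym (*-identityʳ _)) q-prime) (composite⇒¬prime q-composite)
p^[1+k]≤product-of-primes {p} {k} {qs} p-prime p-odd 1≤k qs-prime@(_ ∷ _ ∷ _) _ pᵏ∣N-1 pᵏ∣X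
  with all? (λ q → p ∣? pred q) qs
... | no ¬all = p^[1+k]≤product-¬all-p∣pred {k = k} p-prime qs-prime ¬all (∣-trans (m∣m^n p 1≤k) pᵏ∣N-1) pᵏ∣X
... | yes all-p∣pred = ≤-trans
  (p^[1+k]≤product-of-multiples p-prime p-odd 1≤k (s≤s (s≤s z≤n))
    (map⁺ (All.map prime⇒pred≢0 qs-prime))
    (map⁺ (All.zipWith (λ (q-prime , p∣q-1) → prime∣pred⇒2∣pred p-prime q-prime p∣q-1) (qs-prime , all-p∣pred)))
    (map⁺ all-p∣pred)
    (subst (λ ys → p ^ k ∣ pred (product ys)) (sym suc∘pred≡id) pᵏ∣N-1)
    pᵏ∣X)
  (product-map-pred≤product qs)
  where
  suc∘pred≡id : map suc (map pred qs) ≡ qs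
  suc∘pred≡id = trans (sym (map-∘ qs))
    (map-id-local (All.map (λ q-prime → suc-pred _ {{prime⇒nonZero q-prime}}) qs-prime))

p^[1+k]≤composite : Prime p → ¬ 2 ∣ p → 1 ≤ k → Composite n →
                    p ^ k ∣ pred n → p ^ k ∣ φ n → p ^ suc k ≤ n
p^[1+k]≤composite {p} {k} {n} p-prime p-odd 1≤k n-composite pᵏ∣n-1 pᵏ∣φn
  with factorise n {{composite⇒nonZero n-composite}}
... | record { factors = qs ; isFactorisation = refl ; factorsPrime = qs-prime } =
  p^[1+k]≤product-of-primes p-prime p-odd 1≤k qs-prime n-composite pᵏ∣n-1
    (p^k∣φ⇒∣product-pred {k = k} p-prime qs-prime p∤n pᵏ∣φn)
  where
  instance _ = productOfPrimes≢0 qs-prime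
  p∤n : ¬ p ∣ product qs
  p∤n = prime∣pred⇒∤ {n = product qs} p-prime (∣-trans (m∣m^n p 1≤k) pᵏ∣n-1)

a*p^k+1<p^[1+k] : 1 < p → 1 ≤ k → a < p → a * p ^ k + 1 < p ^ suc k
a*p^k+1<p^[1+k] {p} {k} {a} 1<p 1≤k a<p = begin-strict
  a * p ^ k + 1      <⟨ +-monoʳ-< (a * p ^ k) (^-monoʳ-< p 1<p 1≤k) ⟩
  a * p ^ k + p ^ k  ≡⟨ +-comm (a * p ^ k) (p ^ k) ⟩
  suc a * p ^ k      ≤⟨ *-monoˡ-≤ (p ^ k) a<p ⟩
  p ^ suc k          ∎
  where open ≤-Reasoning

lemma3p2 : (p a k : ℕ) → Prime p → ¬ (p ≡ 2) → 1 ≤ a → 1 ≤ k → a < p →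
           p ^ k ∣ φ (a * p ^ k + 1) → Prime (a * p ^ k + 1)
lemma3p2 p a k p-prime p≢2 1≤a 1≤k a<p pᵏ∣φN = prime λ N-composite →
  <⇒≱ (a*p^k+1<p^[1+k] 1<p 1≤k a<p) (p^[1+k]≤composite p-prime p-odd 1≤k N-composite pᵏ∣N-1 pᵏ∣φN)
  where
  1<p : 1 < p
  1<p = nonTrivial⇒n>1 p {{prime⇒nonTrivial p-prime}}

  instance
    _ = prime⇒nonZero p-prime
    N-nonTrivial : NonTrivial (a * p ^ k + 1)
    N-nonTrivial = n>1⇒nonTrivial (+-monoˡ-≤ 1 (*-mono-≤ 1≤a (m^n>0 p k)))

  p-odd : ¬ 2 ∣ p
  p-odd 2∣p = [ (λ ()) , p≢2 ∘ sym ]′ (prime⇒irreducible p-prime 2∣p)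

  pᵏ∣N-1 : p ^ k ∣ pred (a * p ^ k + 1)
  pᵏ∣N-1 = subst (λ n → p ^ k ∣ pred n) (+-comm 1 (a * p ^ k)) (n∣m*n a)
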